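{- Let $G$ be a $2$-connected graph of order $n$ and let $u,w$ be two distinct vertices of $G$. Let $u_1,u_2$ be two adjacent vertices of the cycle $C_n$ on $n$ vertices. Then $\sigma_G(\{u,w\}) \leq \sigma_{C_n}(\{u_1,u_2\})$.
   Context: All graphs are finite, simple and connected. $d_G(x,y)$ denotes the usual graph distance. For a set $A\subseteq V(G)$ and a vertex $y$, $d_G(y,A)=\min_{a\in A} d_G(y,a)$, and $\sigma_G(A)=\sum_{y\in V(G)\setminus A} d_G(y,A)$. A graph is $2$-connected if it is connected, has at least three vertices, and removing any single vertex leaves it connected. -}

module Defs where

open import Data.Nat using (ℕ; zero; suc; _+_; _∸_; _≤_; _⊓_; _≡ᵇ_)
open import Data.Bool using (Bool; true; false; _∨_; _∧_; if_then_else_; not)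
open import Data.Fin using (Fin; toℕ; _≟_)
open import Data.Bool using () renaming (_≟_ to _≟B_)
open import Data.List using (List; map; foldr; filter; allFin)
open import Data.Bool.ListAction using (any)
open import Data.Nat.ListAction using (sum)
open import Data.Unit using (⊤)
open import Data.Product using (_×_)
open import Relation.Nullary using (¬_)
open import Relation.Nullary.Decidable using (⌊_⌋)
open import Relation.Binary.PropositionalEquality using (_≡_; _≢_)

Adj : ℕ → Set
Adj n = Fin n → Fin n → Bool

record IsSimple {n : ℕ} (adj : Adj n) : Set where
  field
    symmetric   : ∀ x y → adj x y ≡ adj y x
    irreflexive : ∀ x → adj x x ≡ false

data WalkIn {n : ℕ} (adj : Adj n) (P : Fin n → Set) : Fin n → Fin n → Set where
  here : ∀ {x} → P x → WalkIn adj P x x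
  step : ∀ {x y z} → P x → adj x y ≡ true → WalkIn adj P y z → WalkIn adj P x z

Connected : {n : ℕ} → Adj n → Set
Connected {n} adj = ∀ (x y : Fin n) → WalkIn adj (λ _ → ⊤) x y

record TwoConnected {n : ℕ} (adj : Adj n) : Set where
  field
    atLeast3  : 3 ≤ n
    connected : Connected adj
    noCutVertex : ∀ (v x y : Fin n) → x ≢ v → y ≢ v → WalkIn adj (λ z → z ≢ v) x y

reach : {n : ℕ} → Adj n → ℕ → Fin n → Fin n → Bool
reach adj zero    x y = ⌊ x ≟ y ⌋
reach {n} adj (suc k) x y =
  reach adj k x y ∨ any (λ z → reach adj k x z ∧ adj z y) (allFin n)

distFrom : {n : ℕ} → Adj n → Fin n → Fin n → ℕ → ℕ → ℕ
distFrom adj x y zero    k = k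
distFrom adj x y (suc f) k = if reach adj k x y then k else distFrom adj x y f (suc k)

-- graph distance d_G(x,y) = least k with a walk of length ≤ k from x to y
-- (searched among 0..n; in a connected graph the distance is < n)
dist : {n : ℕ} → Adj n → Fin n → Fin n → ℕ
dist {n} adj x y = distFrom adj x y n 0

VSet : ℕ → Set
VSet n = Fin n → Bool

pair : {n : ℕ} → Fin n → Fin n → VSet n
pair u w y = ⌊ y ≟ u ⌋ ∨ ⌊ y ≟ w ⌋

-- d_G(y,A) = min over a ∈ A of d_G(y,a)  (A nonempty; n is an upper bound of all distances)
distSet : {n : ℕ} → Adj n → Fin n → VSet n → ℕ
distSet {n} adj y A = foldr _⊓_ n (map (dist adj y) (filter (λ a → A a ≟B true) (allFin n)))

σ : {n : ℕ} → Adj n → VSet n → ℕ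
σ {n} adj A = sum (map (λ y → if A y then 0 else distSet adj y A) (allFin n))

isSucc : ℕ → ℕ → ℕ → Bool
isSucc n a b = (suc a ≡ᵇ b) ∨ ((suc a ≡ᵇ n) ∧ (b ≡ᵇ 0))

cycle : (n : ℕ) → Adj n
cycle n i j = isSucc n (toℕ i) (toℕ j) ∨ isSucc n (toℕ j) (toℕ i)

-- Let d be the distance to {u, w}. Among the values of d the value 0 occurs twice, and so does
-- every value j + 1 below the maximum: a walk from a vertex beyond level j + 1 to u crosses
-- level j + 1, and by 2-connectivity so does a second walk avoiding the first crossing vertex.
-- A list of n naturals in which each value below the maximum occurs twice sums to at most
-- 0 + 0 + 1 + 1 + 2 + 2 + ⋯ (n terms), by induction after deleting the zeros and decrementing
-- the other entries. In C_n this bound is attained: the distance to an edge dominates a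
-- potential that takes each value at most twice, so it sums to at least as much.
module Submission where

open import Defs
open import Data.Bool using (Bool; true; false; T; _∨_; _∧_; if_then_else_)
open import Data.Bool using () renaming (_≟_ to _≟ᴮ_)
open import Data.Bool.Properties using (∨-zeroʳ)
open import Data.Bool.ListAction using (any)
open import Data.Empty using (⊥; ⊥-elim)
open import Data.Fin using (Fin; toℕ)
import Data.Fin as Fin
open import Data.Fin.Properties using (toℕ<n; toℕ-injective)
open import Data.List using (List; []; _∷_; length; filter; map; allFin)
open import Data.List.Properties
  using (filter-accept; filter-reject; length-map; length-tabulate; map-cong;
         foldr-preservesʳ; foldr-preservesᵒ)
open import Data.List.Membership.Propositional using (_∈_)
open import Data.List.Membership.Propositional.Properties
  using (∈-allFin; ∈-filter⁺; ∈-filter⁻; ∈-map⁺; ∈-map⁻; foldr-selective)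
open import Data.List.Relation.Unary.All as All using (All; []; _∷_)
import Data.List.Relation.Unary.All.Properties as Allₚ
open import Data.List.Relation.Unary.AllPairs using ([]; _∷_)
open import Data.List.Relation.Unary.Any as Any using (Any; here; there; any?; satisfied)
import Data.List.Relation.Unary.Any.Properties as Anyₚ
open import Data.List.Relation.Unary.Unique.Propositional using (Unique)
import Data.List.Relation.Unary.Unique.Propositional.Properties as Unique
open import Data.Nat
  using (ℕ; zero; suc; pred; _+_; _∸_; _⊓_; _≤_; _<_; _≤′_; ≤′-refl; ≤′-step; z≤n; s≤s;
         _≟_; _≤?_; _<?_; _≡ᵇ_)
open import Data.Nat.Induction using (<-wellFounded)
open import Data.Nat.ListAction using (sum)
open import Data.Nat.Properties
open import Data.Product using (∃; ∃₂; _×_; _,_; proj₁; proj₂)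
open import Data.Sum using (_⊎_; inj₁; inj₂; [_,_]; swap)
open import Function using (_∘_)
open import Induction.WellFounded using (Acc; acc)
open import Relation.Binary.PropositionalEquality hiding ([_])
open import Relation.Nullary using (¬_; Dec; yes; no; contradiction)
open import Relation.Nullary.Decidable using (isYes; isYes≗does; dec-true)

-- Lists of naturals

count : ℕ → List ℕ → ℕ
count k = length ∘ filter (_≟ k)

count-hit : ∀ k xs → count k (k ∷ xs) ≡ suc (count k xs)
count-hit k xs = cong length (filter-accept (_≟ k) refl)

count-miss : ∀ {k x} xs → x ≢ k → count k (x ∷ xs) ≡ count k xs
count-miss {k} xs x≢k = cong length (filter-reject (_≟ k) x≢k)

-- staircase m = 0 + 0 + 1 + 1 + 2 + 2 + ⋯ (m terms), which is σ of an edge of the cycle C_m.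
staircase : ℕ → ℕ
staircase zero          = 0
staircase (suc zero)    = 0
staircase (suc (suc m)) = staircase m + m

staircase-suc : ∀ m → staircase m ≤ staircase (suc m)
staircase-suc zero          = z≤n
staircase-suc (suc zero)    = z≤n
staircase-suc (suc (suc m)) = +-mono-≤ (staircase-suc m) (n≤1+n m)

staircase-mono′ : ∀ {m n} → m ≤′ n → staircase m ≤ staircase n
staircase-mono′ ≤′-refl            = ≤-refl
staircase-mono′ (≤′-step {n} m≤′n) = ≤-trans (staircase-mono′ m≤′n) (staircase-suc n)

staircase-mono : ∀ {m n} → m ≤ n → staircase m ≤ staircase n
staircase-mono = staircase-mono′ ∘ ≤⇒≤′

shrink : List ℕ → List ℕ
shrink []           = []
shrink (zero  ∷ xs) = shrink xs
shrink (suc x ∷ xs) = x ∷ shrink xs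

sum-shrink : ∀ xs → sum xs ≡ sum (shrink xs) + length (shrink xs)
sum-shrink []           = refl
sum-shrink (zero  ∷ xs) = sum-shrink xs
sum-shrink (suc x ∷ xs) = begin
  suc x + sum xs                                  ≡⟨ cong (suc x +_) (sum-shrink xs) ⟩
  suc x + (sum (shrink xs) + length (shrink xs))  ≡⟨ cong suc (+-assoc x _ _) ⟨
  suc (x + sum (shrink xs) + length (shrink xs))  ≡⟨ +-suc _ _ ⟨
  x + sum (shrink xs) + suc (length (shrink xs))  ∎
  where open ≡-Reasoning

length-shrink : ∀ xs → length xs ≡ count 0 xs + length (shrink xs)
length-shrink []           = refl
length-shrink (zero  ∷ xs) = cong suc (length-shrink xs)
length-shrink (suc x ∷ xs) = trans (cong suc (length-shrink xs)) (sym (+-suc _ _))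

count-shrink : ∀ k xs → count k (shrink xs) ≡ count (suc k) xs
count-shrink k []           = refl
count-shrink k (zero  ∷ xs) = count-shrink k xs
count-shrink k (suc x ∷ xs) with x ≟ k
... | yes refl = begin
  count k (k ∷ shrink xs)     ≡⟨ count-hit k (shrink xs) ⟩
  suc (count k (shrink xs))   ≡⟨ cong suc (count-shrink k xs) ⟩
  suc (count (suc k) xs)      ≡⟨ count-hit (suc k) xs ⟨
  count (suc k) (suc k ∷ xs)  ∎
  where open ≡-Reasoning
... | no  x≢k = begin
  count k (x ∷ shrink xs)     ≡⟨ count-miss (shrink xs) x≢k ⟩
  count k (shrink xs)         ≡⟨ count-shrink k xs ⟩
  count (suc k) xs            ≡⟨ count-miss xs (x≢k ∘ suc-injective) ⟨
  count (suc k) (suc x ∷ xs)  ∎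
  where open ≡-Reasoning

any-shrink : ∀ k xs → Any (k <_) (shrink xs) → Any (suc k <_) xs
any-shrink k (zero  ∷ xs) p          = there (any-shrink k xs p)
any-shrink k (suc x ∷ xs) (here k<x) = here (s≤s k<x)
any-shrink k (suc x ∷ xs) (there p)  = there (any-shrink k xs p)

shrink-lighter : ∀ x xs →
                 sum (shrink (x ∷ xs)) + length (shrink (x ∷ xs)) < sum (x ∷ xs) + length (x ∷ xs)
shrink-lighter x xs =
  subst (_< sum (x ∷ xs) + length (x ∷ xs)) (sum-shrink (x ∷ xs)) (m<m+n _ (s≤s z≤n))

sum-nonpositive : ∀ xs → ¬ Any (0 <_) xs → sum xs ≡ 0
sum-nonpositive []           _    = refl
sum-nonpositive (zero  ∷ xs) none = sum-nonpositive xs (none ∘ there)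
sum-nonpositive (suc x ∷ xs) none = contradiction (here (s≤s z≤n)) none

sum≤staircase : ∀ xs → (∀ k → Any (k <_) xs → 2 ≤ count k xs) → sum xs ≤ staircase (length xs)
sum≤staircase xs = go xs (<-wellFounded _)
  where
  go : ∀ xs → Acc _<_ (sum xs + length xs) → (∀ k → Any (k <_) xs → 2 ≤ count k xs) →
       sum xs ≤ staircase (length xs)
  go []           _         _     = z≤n
  go xs@(x ∷ xs′) (acc rec) twice with any? (0 <?_) xs
  ... | no  none = ≤-trans (≤-reflexive (sum-nonpositive xs none)) z≤n
  ... | yes some = begin
      sum xs                     ≡⟨ sum-shrink xs ⟩
      sum ys + length ys         ≤⟨ +-monoˡ-≤ (length ys) (go ys (rec (shrink-lighter x xs′)) twice′) ⟩
      staircase (2 + length ys)  ≤⟨ staircase-mono two-zeros ⟩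
      staircase (length xs)      ∎
    where
    open ≤-Reasoning
    ys = shrink xs
    twice′ : ∀ k → Any (k <_) ys → 2 ≤ count k ys
    twice′ k p = subst (2 ≤_) (sym (count-shrink k xs)) (twice (suc k) (any-shrink k xs p))
    two-zeros : 2 + length ys ≤ length xs
    two-zeros = subst (2 + length ys ≤_) (sym (length-shrink xs))
                      (+-monoˡ-≤ (length ys) (twice 0 some))

staircase≤sum : ∀ xs → (∀ k → count k xs ≤ 2) → staircase (length xs) ≤ sum xs
staircase≤sum xs = go xs (<-wellFounded _)
  where
  go : ∀ xs → Acc _<_ (sum xs + length xs) → (∀ k → count k xs ≤ 2) →
       staircase (length xs) ≤ sum xs
  go []           _         _       = z≤n
  go xs@(x ∷ xs′) (acc rec) atMost2 = begin
      staircase (length xs)      ≤⟨ staircase-mono few-zeros ⟩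
      staircase (2 + length ys)  ≤⟨ +-monoˡ-≤ (length ys) (go ys (rec (shrink-lighter x xs′)) atMost2′) ⟩
      sum ys + length ys         ≡⟨ sum-shrink xs ⟨
      sum xs                     ∎
    where
    open ≤-Reasoning
    ys = shrink xs
    atMost2′ : ∀ k → count k ys ≤ 2
    atMost2′ k = subst (_≤ 2) (sym (count-shrink k xs)) (atMost2 (suc k))
    few-zeros : length xs ≤ 2 + length ys
    few-zeros = subst (_≤ 2 + length ys) (sym (length-shrink xs))
                      (+-monoˡ-≤ (length ys) (atMost2 0))

sum-map-mono : ∀ {A : Set} {f g : A → ℕ} → (∀ x → f x ≤ g x) →
               ∀ xs → sum (map f xs) ≤ sum (map g xs)
sum-map-mono f≤g []       = z≤n
sum-map-mono f≤g (x ∷ xs) = +-mono-≤ (f≤g x) (sum-map-mono f≤g xs)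

-- Counting the values of a function on Fin n

count-map : ∀ {A : Set} (f : A → ℕ) k xs →
            count k (map f xs) ≡ length (filter (λ x → f x ≟ k) xs)
count-map f k []       = refl
count-map f k (x ∷ xs) with f x ≟ k
... | yes fx≡k = begin
  count k (map f (x ∷ xs))                  ≡⟨ cong (count k ∘ (_∷ map f xs)) fx≡k ⟩
  count k (k ∷ map f xs)                    ≡⟨ count-hit k (map f xs) ⟩
  suc (count k (map f xs))                  ≡⟨ cong suc (count-map f k xs) ⟩
  suc (length (filter (λ x → f x ≟ k) xs))  ≡⟨ cong length (filter-accept (λ x → f x ≟ k) fx≡k) ⟨
  length (filter (λ x → f x ≟ k) (x ∷ xs))  ∎
  where open ≡-Reasoning
... | no fx≢k = begin
  count k (map f (x ∷ xs))                  ≡⟨ count-miss (map f xs) fx≢k ⟩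
  count k (map f xs)                        ≡⟨ count-map f k xs ⟩
  length (filter (λ x → f x ≟ k) xs)        ≡⟨ cong length (filter-reject (λ x → f x ≟ k) fx≢k) ⟨
  length (filter (λ x → f x ≟ k) (x ∷ xs))  ∎
  where open ≡-Reasoning

2≤length : ∀ {A : Set} {x y : A} {xs} → x ∈ xs → y ∈ xs → x ≢ y → 2 ≤ length xs
2≤length (here refl)              (here refl)  x≢y = contradiction refl x≢y
2≤length {xs = _ ∷ _ ∷ _} (here _)  (there _)    _   = s≤s (s≤s z≤n)
2≤length {xs = _ ∷ _ ∷ _} (there _) (here _)     _   = s≤s (s≤s z≤n)
2≤length (there x∈xs)             (there y∈xs) x≢y = m≤n⇒m≤1+n (2≤length x∈xs y∈xs x≢y)

three-in-pair : ∀ {A : Set} {a b x y z : A} →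
                x ≡ a ⊎ x ≡ b → y ≡ a ⊎ y ≡ b → z ≡ a ⊎ z ≡ b → x ≢ y → x ≢ z → y ≢ z → ⊥
three-in-pair (inj₁ refl) (inj₁ refl) _           x≢y _   _   = x≢y refl
three-in-pair (inj₂ refl) (inj₂ refl) _           x≢y _   _   = x≢y refl
three-in-pair (inj₁ refl) (inj₂ refl) (inj₁ refl) _   x≢z _   = x≢z refl
three-in-pair (inj₁ refl) (inj₂ refl) (inj₂ refl) _   _   y≢z = y≢z refl
three-in-pair (inj₂ refl) (inj₁ refl) (inj₁ refl) _   _   y≢z = y≢z refl
three-in-pair (inj₂ refl) (inj₁ refl) (inj₂ refl) _   x≢z _   = x≢z refl

unique-in-pair⇒length≤2 : ∀ {A : Set} {a b : A} {xs} →
                          Unique xs → All (λ x → x ≡ a ⊎ x ≡ b) xs → length xs ≤ 2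
unique-in-pair⇒length≤2 {xs = []}         _ _ = z≤n
unique-in-pair⇒length≤2 {xs = _ ∷ []}     _ _ = s≤s z≤n
unique-in-pair⇒length≤2 {xs = _ ∷ _ ∷ []} _ _ = s≤s (s≤s z≤n)
unique-in-pair⇒length≤2 {xs = _ ∷ _ ∷ _ ∷ _}
  ((x≢y ∷ x≢z ∷ _) ∷ (y≢z ∷ _) ∷ _) (x∈ ∷ y∈ ∷ z∈ ∷ _) =
  ⊥-elim (three-in-pair x∈ y∈ z∈ x≢y x≢z y≢z)

length-values : ∀ {n} (f : Fin n → ℕ) → length (map f (allFin n)) ≡ n
length-values {n} f = trans (length-map f (allFin n)) (length-tabulate _)

2≤count-values : ∀ {n} (f : Fin n → ℕ) {k y₁ y₂} → y₁ ≢ y₂ → f y₁ ≡ k → f y₂ ≡ k →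
                 2 ≤ count k (map f (allFin n))
2≤count-values {n} f {k} {y₁} {y₂} y₁≢y₂ fy₁≡k fy₂≡k =
  subst (2 ≤_) (sym (count-map f k (allFin n)))
    (2≤length (∈-filter⁺ P? (∈-allFin y₁) fy₁≡k) (∈-filter⁺ P? (∈-allFin y₂) fy₂≡k) y₁≢y₂)
  where P? = λ y → f y ≟ k

count-values≤2 : ∀ {n} (f h : Fin n → ℕ) → (∀ {x y} → h x ≡ h y → x ≡ y) →
                 ∀ {k a b} → (∀ y → f y ≡ k → h y ≡ a ⊎ h y ≡ b) →
                 count k (map f (allFin n)) ≤ 2
count-values≤2 {n} f h h-injective {k} fibre = begin
  count k (map f (allFin n))  ≡⟨ count-map f k (allFin n) ⟩
  length ys                   ≡⟨ length-map h ys ⟨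
  length (map h ys)           ≤⟨ unique-in-pair⇒length≤2 unique in-pair ⟩
  2                           ∎
  where
  open ≤-Reasoning
  P? = λ y → f y ≟ k
  ys = filter P? (allFin n)
  unique : Unique (map h ys)
  unique = Unique.map⁺ h-injective (Unique.filter⁺ P? {allFin n} (Unique.allFin⁺ n))
  in-pair : All (λ c → c ≡ _ ⊎ c ≡ _) (map h ys)
  in-pair = Allₚ.map⁺ (All.tabulate (λ y∈ys → fibre _ (proj₂ (∈-filter⁻ P? {xs = allFin n} y∈ys))))

-- Distances

∨-introˡ : ∀ {a} b → a ≡ true → a ∨ b ≡ true
∨-introˡ b refl = refl

∨-introʳ : ∀ a {b} → b ≡ true → a ∨ b ≡ true
∨-introʳ a refl = ∨-zeroʳ a

∨-elim : ∀ a {b} → a ∨ b ≡ true → a ≡ true ⊎ b ≡ true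
∨-elim true  _  = inj₁ refl
∨-elim false b≡ = inj₂ b≡

∧-elim : ∀ a {b} → a ∧ b ≡ true → a ≡ true × b ≡ true
∧-elim true b≡ = refl , b≡

any-intro : ∀ {A : Set} (f : A → Bool) {x xs} → x ∈ xs → f x ≡ true → any f xs ≡ true
any-intro f (here refl)  fx = ∨-introˡ _ fx
any-intro f (there x∈xs) fx = ∨-introʳ _ (any-intro f x∈xs fx)

any-elim : ∀ {A : Set} (f : A → Bool) xs → any f xs ≡ true → ∃ λ x → f x ≡ true
any-elim f (x ∷ xs) e with ∨-elim (f x) e
... | inj₁ fx  = x , fx
... | inj₂ any = any-elim f xs any

isYes⇒ : ∀ {P : Set} (P? : Dec P) → isYes P? ≡ true → P
isYes⇒ (yes p) _ = p

isYes-refl : ∀ {n} (x : Fin n) → isYes (x Fin.≟ x) ≡ true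
isYes-refl x = trans (isYes≗does (x Fin.≟ x)) (dec-true (x Fin.≟ x) refl)

≡ᵇ-true : ∀ {a b} → (a ≡ᵇ b) ≡ true → a ≡ b
≡ᵇ-true {a} {b} e = ≡ᵇ⇒≡ a b (subst T (sym e) _)

pair-left : ∀ {n} (u w : Fin n) → pair u w u ≡ true
pair-left u w = ∨-introˡ _ (isYes-refl u)

pair-right : ∀ {n} (u w : Fin n) → pair u w w ≡ true
pair-right u w = ∨-introʳ _ (isYes-refl w)

pair-elim : ∀ {n} {u w y : Fin n} → pair u w y ≡ true → y ≡ u ⊎ y ≡ w
pair-elim {u = u} {w} {y} e with ∨-elim (isYes (y Fin.≟ u)) e
... | inj₁ y≡u = inj₁ (isYes⇒ (y Fin.≟ u) y≡u)
... | inj₂ y≡w = inj₂ (isYes⇒ (y Fin.≟ w) y≡w)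

module Reachability {n : ℕ} (adj : Adj n) where

  reach-refl : ∀ j x → reach adj j x x ≡ true
  reach-refl zero    x = isYes-refl x
  reach-refl (suc j) x = ∨-introˡ _ (reach-refl j x)

  reach-snoc : ∀ {j x y z} → reach adj j x y ≡ true → adj y z ≡ true →
               reach adj (suc j) x z ≡ true
  reach-snoc {j} {x} {y} {z} r e = ∨-introʳ (reach adj j x z)
    (any-intro (λ t → reach adj j x t ∧ adj t z) (∈-allFin y) (trans (cong (_∧ adj y z) r) e))

  reach-suc⁻ : ∀ {j x z} → reach adj (suc j) x z ≡ true →
               reach adj j x z ≡ true ⊎ ∃ λ y → reach adj j x y ≡ true × adj y z ≡ true
  reach-suc⁻ {j} {x} {z} r with ∨-elim (reach adj j x z) r
  ... | inj₁ r′ = inj₁ r′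
  ... | inj₂ e with any-elim (λ t → reach adj j x t ∧ adj t z) (allFin n) e
  ...   | y , e′ = inj₂ (y , ∧-elim (reach adj j x y) e′)

  reach-cons : ∀ {j x y z} → adj x y ≡ true → reach adj j y z ≡ true →
               reach adj (suc j) x z ≡ true
  reach-cons {zero} {x} {y} {z} e r with isYes⇒ (y Fin.≟ z) r
  ... | refl = reach-snoc {0} {x} (reach-refl 0 x) e
  reach-cons {suc j} {x} {y} {z} e r with reach-suc⁻ {j} {y} {z} r
  ... | inj₁ r′            = ∨-introˡ _ (reach-cons {j} e r′)
  ... | inj₂ (t , r′ , e′) = reach-snoc {suc j} {x} {t} (reach-cons {j} e r′) e′

  distFrom≤ : ∀ {j x y} f k → reach adj j x y ≡ true → k ≤ j → distFrom adj x y f k ≤ j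
  distFrom≤ zero k r k≤j = k≤j
  distFrom≤ {j} {x} {y} (suc f) k r k≤j with reach adj k x y in e
  ... | true  = k≤j
  ... | false with m≤n⇒m<n∨m≡n k≤j
  ...   | inj₁ k<j  = distFrom≤ f (suc k) r k<j
  ...   | inj₂ refl with () ← trans (sym r) e

  distFrom-realised : ∀ x y f k →
                      distFrom adj x y f k ≡ f + k ⊎ reach adj (distFrom adj x y f k) x y ≡ true
  distFrom-realised x y zero    k = inj₁ refl
  distFrom-realised x y (suc f) k with reach adj k x y in e
  ... | true  = inj₂ e
  ... | false with distFrom-realised x y f (suc k)
  ...   | inj₁ d≡ = inj₁ (trans d≡ (+-suc f k))
  ...   | inj₂ r  = inj₂ r

  dist≤ : ∀ {j x y} → reach adj j x y ≡ true → dist adj x y ≤ j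
  dist≤ r = distFrom≤ n 0 r z≤n

  dist-realised : ∀ x y → dist adj x y ≡ n ⊎ reach adj (dist adj x y) x y ≡ true
  dist-realised x y with distFrom-realised x y n 0
  ... | inj₁ d≡ = inj₁ (trans d≡ (+-identityʳ n))
  ... | inj₂ r  = inj₂ r

Lipschitz : ∀ {n} → Adj n → (Fin n → ℕ) → Set
Lipschitz adj f = ∀ {x y} → adj x y ≡ true → f x ≤ suc (f y)

module DistanceToSet {n : ℕ} (adj : Adj n) (A : VSet n) where
  open Reachability adj

  private
    distances : Fin n → List ℕ
    distances y = map (dist adj y) (filter (λ a → A a ≟ᴮ true) (allFin n))

  distSet≤dist : ∀ y {a} → A a ≡ true → distSet adj y A ≤ dist adj y a
  distSet≤dist y {a} Aa =
    foldr-preservesᵒ ⊓-≤ n (distances y) (inj₂ (Any.map (≤-reflexive ∘ sym) a∈))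
    where
    ⊓-≤ : ∀ p q → p ≤ dist adj y a ⊎ q ≤ dist adj y a → p ⊓ q ≤ dist adj y a
    ⊓-≤ p q = [ ≤-trans (m⊓n≤m p q) , ≤-trans (m⊓n≤n p q) ]
    a∈ = ∈-map⁺ (dist adj y) (∈-filter⁺ (λ a → A a ≟ᴮ true) (∈-allFin a) Aa)

  distSet≤n : ∀ y → distSet adj y A ≤ n
  distSet≤n y = foldr-preservesʳ {P = _≤ n} (λ p {q} → ≤-trans (m⊓n≤n p q)) ≤-refl (distances y)

  distSet-realised : ∀ y → distSet adj y A ≡ n ⊎
                           ∃ λ a → A a ≡ true × reach adj (distSet adj y A) y a ≡ true
  distSet-realised y with foldr-selective ⊓-sel n (distances y)
  ... | inj₁ d≡n = inj₁ d≡n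
  ... | inj₂ d∈ with ∈-map⁻ (dist adj y) d∈
  ...   | a , a∈ , d≡ with ∈-filter⁻ (λ a → A a ≟ᴮ true) {xs = allFin n} a∈ | dist-realised y a
  ...     | _ , Aa | inj₁ dist≡n = inj₁ (trans d≡ dist≡n)
  ...     | _ , Aa | inj₂ r      = inj₂ (a , Aa , subst (λ j → reach adj j y a ≡ true) (sym d≡) r)

  distSet-member : ∀ {y} → A y ≡ true → distSet adj y A ≡ 0
  distSet-member {y} Ay = n≤0⇒n≡0 (≤-trans (distSet≤dist y Ay) (dist≤ {0} (reach-refl 0 y)))

  distSet-lipschitz : Lipschitz adj (λ y → distSet adj y A)
  distSet-lipschitz {x} {y} e with distSet-realised y
  ... | inj₁ d≡n          = ≤-trans (distSet≤n x) (≤-trans (≤-reflexive (sym d≡n)) (n≤1+n _))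
  ... | inj₂ (a , Aa , r) = ≤-trans (distSet≤dist x Aa) (dist≤ (reach-cons {distSet adj y A} e r))

  reach-lipschitz : ∀ {f} → Lipschitz adj f → ∀ {j x y} → reach adj j x y ≡ true → f x ≤ j + f y
  reach-lipschitz lip {zero} {x} {y} r with isYes⇒ (x Fin.≟ y) r
  ... | refl = ≤-refl
  reach-lipschitz {f} lip {suc j} {x} {y} r with reach-suc⁻ {j} r
  ... | inj₁ r′ = ≤-trans (reach-lipschitz lip {j} r′) (n≤1+n _)
  ... | inj₂ (t , r′ , e) = begin
    f x            ≤⟨ reach-lipschitz lip {j} r′ ⟩
    j + f t        ≤⟨ +-monoʳ-≤ j (lip e) ⟩
    j + suc (f y)  ≡⟨ +-suc j (f y) ⟩
    suc j + f y    ∎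
    where open ≤-Reasoning

  lipschitz≤distSet : ∀ {f} → Lipschitz adj f → (∀ {a} → A a ≡ true → f a ≡ 0) →
                      (∀ y → f y ≤ n) → ∀ y → f y ≤ distSet adj y A
  lipschitz≤distSet {f} lip zero-on-A f≤n y with distSet-realised y
  ... | inj₁ d≡n          = subst (f y ≤_) (sym d≡n) (f≤n y)
  ... | inj₂ (a , Aa , r) = subst (f y ≤_) (trans (cong (distSet adj y A +_) (zero-on-A Aa))
                                                  (+-identityʳ _))
                                  (reach-lipschitz lip r)

  σ≡sum-distSet : σ adj A ≡ sum (map (λ y → distSet adj y A) (allFin n))
  σ≡sum-distSet = cong sum (map-cong outside-A (allFin n))
    where
    outside-A : ∀ y → (if A y then 0 else distSet adj y A) ≡ distSet adj y A
    outside-A y with A y in Ay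
    ... | true  = sym (distSet-member Ay)
    ... | false = refl

-- The 2-connected graph

walk-crosses-level : ∀ {n} {adj : Adj n} {P : Fin n → Set} {f : Fin n → ℕ} → Lipschitz adj f →
                     ∀ {j x t} → WalkIn adj P x t → j < f x → f t ≤ j →
                     ∃ λ z → P z × f z ≡ suc j
walk-crosses-level lip (here _) j<fx fx≤j = contradiction fx≤j (<⇒≱ j<fx)
walk-crosses-level {f = f} lip {j} (step {x} {y} Px e walk) j<fx ft≤j with j <? f y
... | yes j<fy = walk-crosses-level lip walk j<fy ft≤j
... | no  j≮fy = x , Px , ≤-antisym (≤-trans (lip e) (s≤s (≮⇒≥ j≮fy))) j<fx

two-vertices-at-level : ∀ {n} {adj : Adj n} {f : Fin n → ℕ} → TwoConnected adj → Lipschitz adj f →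
                        ∀ {j u y} → f u ≤ j → suc j < f y →
                        ∃₂ λ z₁ z₂ → z₁ ≢ z₂ × f z₁ ≡ suc j × f z₂ ≡ suc j
two-vertices-at-level {f = f} 2-conn lip {j} {u} {y} fu≤j j+1<fy =
  let z₁ , _      , fz₁ = walk-crosses-level lip (connected y u) j<fy fu≤j
      z₂ , z₂≢z₁ , fz₂ = walk-crosses-level lip (noCutVertex z₁ y u (y≢ fz₁) (u≢ fz₁)) j<fy fu≤j
  in z₁ , z₂ , ≢-sym z₂≢z₁ , fz₁ , fz₂
  where
  open TwoConnected 2-conn
  j<fy : j < f y
  j<fy = <-trans (n<1+n j) j+1<fy
  y≢ : ∀ {z} → f z ≡ suc j → y ≢ z
  y≢ fz refl = <-irrefl (sym fz) j+1<fy
  u≢ : ∀ {z} → f z ≡ suc j → u ≢ z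
  u≢ fz refl = <⇒≱ (subst (j <_) (sym fz) (n<1+n j)) fu≤j

σ≤staircase : ∀ {n} {adj : Adj n} → TwoConnected adj → ∀ {u w} → u ≢ w →
              σ adj (pair u w) ≤ staircase n
σ≤staircase {n} {adj} 2-conn {u} {w} u≢w = begin
  σ adj (pair u w)                       ≡⟨ σ≡sum-distSet ⟩
  sum (map d (allFin n))                 ≤⟨ sum≤staircase (map d (allFin n)) twice ⟩
  staircase (length (map d (allFin n)))  ≡⟨ cong staircase (length-values d) ⟩
  staircase n                            ∎
  where
  open DistanceToSet adj (pair u w)
  open ≤-Reasoning
  d : Fin n → ℕ
  d y = distSet adj y (pair u w)
  du≡0 : d u ≡ 0
  du≡0 = distSet-member (pair-left u w)
  twice : ∀ k → Any (k <_) (map d (allFin n)) → 2 ≤ count k (map d (allFin n))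
  twice zero    _ = 2≤count-values d u≢w du≡0 (distSet-member (pair-right u w))
  twice (suc j) far with satisfied (Anyₚ.map⁻ far)
  ... | y , j+1<dy
    with two-vertices-at-level 2-conn distSet-lipschitz {j} {u} {y} (subst (_≤ j) (sym du≡0) z≤n) j+1<dy
  ...   | z₁ , z₂ , z₁≢z₂ , dz₁ , dz₂ = 2≤count-values d z₁≢z₂ dz₁ dz₂

-- The cycle

data CyclicSucc (n : ℕ) : ℕ → ℕ → Set where
  next : ∀ {a} → CyclicSucc n a (suc a)
  wrap : ∀ {a} → suc a ≡ n → CyclicSucc n a 0

isSucc⇒CyclicSucc : ∀ {n a b} → isSucc n a b ≡ true → CyclicSucc n a b
isSucc⇒CyclicSucc {n} {a} {b} e with ∨-elim (suc a ≡ᵇ b) e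
... | inj₁ a+1≡b with refl ← ≡ᵇ-true {suc a} {b} a+1≡b = next
... | inj₂ e′ with ∧-elim (suc a ≡ᵇ n) e′
...   | a+1≡n , b≡0 with refl ← ≡ᵇ-true {b} {0} b≡0 = wrap (≡ᵇ-true a+1≡n)

≤suc-pred : ∀ m → m ≤ suc (pred m)
≤suc-pred zero    = z≤n
≤suc-pred (suc m) = ≤-refl

module EdgeDistance (n : ℕ) where

  -- the distance in C_n from vertex t to the edge {0, 1}
  edgeDistance : ℕ → ℕ
  edgeDistance t = pred t ⊓ (n ∸ t)

  edgeDistance-cyclicSucc : ∀ {t t′} → CyclicSucc n t t′ →
                            edgeDistance t ≤ suc (edgeDistance t′) ×
                            edgeDistance t′ ≤ suc (edgeDistance t)
  edgeDistance-cyclicSucc {t} next =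
    ⊓-mono-≤ (≤-trans pred[n]≤n (n≤1+n t))
             (subst (n ∸ t ≤_) (cong suc (pred[m∸n]≡m∸[1+n] n t)) (≤suc-pred (n ∸ t))) ,
    ⊓-mono-≤ (≤suc-pred t) (≤-trans (∸-monoʳ-≤ n (n≤1+n t)) (n≤1+n _))
  edgeDistance-cyclicSucc {t} (wrap t+1≡n) =
    ≤-trans (m⊓n≤n (pred t) (n ∸ t)) (≤-reflexive (trans (cong (_∸ t) (sym t+1≡n)) (m+n∸n≡m 1 t))) ,
    z≤n

  edgeDistance-after-0 : ∀ {t} → CyclicSucc n 0 t → edgeDistance t ≡ 0
  edgeDistance-after-0 next     = refl
  edgeDistance-after-0 (wrap _) = refl

  -- The second vertex at distance k from the edge; for k = 0 it is 0 itself, as pred 0 = 0.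
  mirror : ℕ → ℕ
  mirror zero    = 0
  mirror (suc k) = n ∸ suc k

  edgeDistance-fibre : ∀ {t k} → t < n → edgeDistance t ≡ k → t ≡ suc k ⊎ t ≡ mirror k
  edgeDistance-fibre {t} {k} t<n e with ⊓-sel (pred t) (n ∸ t)
  edgeDistance-fibre {zero}  t<n e | inj₁ _  = inj₂ (cong mirror e)
  edgeDistance-fibre {suc t} t<n e | inj₁ e′ = inj₁ (cong suc (trans (sym e′) e))
  edgeDistance-fibre {t} {zero}  t<n e | inj₂ e′ =
    contradiction (trans (sym e′) e) (>⇒≢ (m<n⇒0<n∸m t<n))
  edgeDistance-fibre {t} {suc k} t<n e | inj₂ e′ =
    inj₂ (trans (sym (m∸[m∸n]≡n (<⇒≤ t<n))) (cong (n ∸_) (trans (sym e′) e)))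

suc[a+n∸suc[a]]≡n : ∀ a {n} → a < n → suc (a + n ∸ suc a) ≡ n
suc[a+n∸suc[a]]≡n a {suc n} _ = cong suc (trans (cong (_∸ suc a) (+-suc a n)) (m+n∸m≡n a n))

module Rotation (n p : ℕ) (p<n : p < n) where

  rotate : ℕ → ℕ
  rotate i with p ≤? i
  ... | yes _ = i ∸ p
  ... | no  _ = i + n ∸ p

  private
    p≤i+n : ∀ i → p ≤ i + n
    p≤i+n i = ≤-trans (<⇒≤ p<n) (m≤n+m n i)

  rotate-self : rotate p ≡ 0
  rotate-self with p ≤? p
  ... | yes _   = n∸n≡0 p
  ... | no  p≰p = contradiction ≤-refl p≰p

  rotate<n : ∀ {i} → i < n → rotate i < n
  rotate<n {i} i<n with p ≤? i
  ... | yes _   = ≤-<-trans (m∸n≤m i p) i<n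
  ... | no  p≰i =
    subst (i + n ∸ p <_) (m+n∸m≡n p n) (∸-monoˡ-< (+-monoˡ-< n (≰⇒> p≰i)) (p≤i+n i))

  rotate-injective : ∀ {i j} → i < n → j < n → rotate i ≡ rotate j → i ≡ j
  rotate-injective {i} {j} i<n j<n e with p ≤? i | p ≤? j
  ... | yes p≤i | yes p≤j = ∸-cancelʳ-≡ p≤i p≤j e
  ... | no  _   | no  _   = +-cancelʳ-≡ n i j (∸-cancelʳ-≡ (p≤i+n i) (p≤i+n j) e)
  ... | yes p≤i | no  _   =
    contradiction e (<⇒≢ (<-≤-trans (∸-monoˡ-< i<n p≤i) (∸-monoˡ-≤ p (m≤n+m n j))))
  ... | no  _   | yes p≤j =
    contradiction e (>⇒≢ (<-≤-trans (∸-monoˡ-< j<n p≤j) (∸-monoˡ-≤ p (m≤n+m n i))))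

  rotate-cyclicSucc : ∀ {a b} → a < n → CyclicSucc n a b → CyclicSucc n (rotate a) (rotate b)
  rotate-cyclicSucc {a} a<n next with p ≤? a | p ≤? suc a
  ... | yes p≤a | yes _     = subst (CyclicSucc n (a ∸ p)) (sym (+-∸-assoc 1 p≤a)) next
  ... | yes p≤a | no  p≰a+1 = contradiction (m≤n⇒m≤1+n p≤a) p≰a+1
  ... | no  p≰a | no  _     = subst (CyclicSucc n (a + n ∸ p)) (sym (+-∸-assoc 1 (p≤i+n a))) next
  ... | no  p≰a | yes p≤a+1 with refl ← ≤-antisym p≤a+1 (≰⇒> p≰a) =
    subst (CyclicSucc n (a + n ∸ suc a)) (sym (n∸n≡0 (suc a))) (wrap (suc[a+n∸suc[a]]≡n a a<n))
  rotate-cyclicSucc {a} a<n (wrap a+1≡n) with p ≤? a | p ≤? 0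
  ... | yes p≤a | yes p≤0 with refl ← n≤0⇒n≡0 p≤0 = wrap a+1≡n
  ... | yes p≤a | no  _   =
    subst (CyclicSucc n (a ∸ p)) (trans (sym (+-∸-assoc 1 p≤a)) (cong (_∸ p) a+1≡n)) next
  ... | no  p≰a | _       = contradiction (≤-pred (subst (p <_) (sym a+1≡n) p<n)) p≰a

module EdgePotential {n : ℕ} {a b : Fin n} (ab : CyclicSucc n (toℕ a) (toℕ b)) where
  open EdgeDistance n
  open Rotation n (toℕ a) (toℕ<n a)

  offset : Fin n → ℕ
  offset y = rotate (toℕ y)

  potential : Fin n → ℕ
  potential y = edgeDistance (offset y)

  potential-lipschitz : Lipschitz (cycle n) potential
  potential-lipschitz {x} {y} e with ∨-elim (isSucc n (toℕ x) (toℕ y)) e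
  ... | inj₁ x→y = proj₁ (edgeDistance-cyclicSucc (rotate-cyclicSucc (toℕ<n x) (isSucc⇒CyclicSucc x→y)))
  ... | inj₂ y→x = proj₂ (edgeDistance-cyclicSucc (rotate-cyclicSucc (toℕ<n y) (isSucc⇒CyclicSucc y→x)))

  potential≤n : ∀ y → potential y ≤ n
  potential≤n y = ≤-trans (m⊓n≤n (pred (offset y)) (n ∸ offset y)) (m∸n≤m n (offset y))

  potential-ends : ∀ {y} → y ≡ a ⊎ y ≡ b → potential y ≡ 0
  potential-ends (inj₁ refl) = cong edgeDistance rotate-self
  potential-ends (inj₂ refl) = edgeDistance-after-0
    (subst (λ r → CyclicSucc n r (offset b)) rotate-self (rotate-cyclicSucc (toℕ<n a) ab))

  potential-fibre : ∀ {k} y → potential y ≡ k → offset y ≡ suc k ⊎ offset y ≡ mirror k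
  potential-fibre y = edgeDistance-fibre (rotate<n (toℕ<n y))

  offset-injective : ∀ {x y} → offset x ≡ offset y → x ≡ y
  offset-injective {x} {y} = toℕ-injective ∘ rotate-injective (toℕ<n x) (toℕ<n y)

staircase≤σ-cycle : ∀ {n} {a b : Fin n} → CyclicSucc n (toℕ a) (toℕ b) →
                    ∀ {A : VSet n} → (∀ {y} → A y ≡ true → y ≡ a ⊎ y ≡ b) →
                    staircase n ≤ σ (cycle n) A
staircase≤σ-cycle {n} ab {A} A⊆ab = begin
  staircase n                                         ≡⟨ cong staircase (length-values potential) ⟨
  staircase (length (map potential (allFin n)))       ≤⟨ staircase≤sum (map potential (allFin n)) atMost2 ⟩
  sum (map potential (allFin n))                      ≤⟨ sum-map-mono below-distance (allFin n) ⟩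
  sum (map (λ y → distSet (cycle n) y A) (allFin n))  ≡⟨ σ≡sum-distSet ⟨
  σ (cycle n) A                                       ∎
  where
  open ≤-Reasoning
  open EdgePotential ab
  open DistanceToSet (cycle n) A
  atMost2 : ∀ k → count k (map potential (allFin n)) ≤ 2
  atMost2 k = count-values≤2 potential offset offset-injective potential-fibre
  below-distance : ∀ y → potential y ≤ distSet (cycle n) y A
  below-distance = lipschitz≤distSet potential-lipschitz (potential-ends ∘ A⊆ab) potential≤n

staircase≤σ-edge : ∀ {n} {u₁ u₂ : Fin n} → cycle n u₁ u₂ ≡ true →
                   staircase n ≤ σ (cycle n) (pair u₁ u₂)
staircase≤σ-edge {n} {u₁} {u₂} e with ∨-elim (isSucc n (toℕ u₁) (toℕ u₂)) e
... | inj₁ u₁→u₂ = staircase≤σ-cycle (isSucc⇒CyclicSucc u₁→u₂) (pair-elim {u = u₁})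
... | inj₂ u₂→u₁ = staircase≤σ-cycle (isSucc⇒CyclicSucc u₂→u₁) (swap ∘ pair-elim {u = u₁})

corollary1 : (n : ℕ) (adj : Adj n) → IsSimple adj → TwoConnected adj →
    (u w : Fin n) → u ≢ w → (u₁ u₂ : Fin n) → cycle n u₁ u₂ ≡ true →
    σ adj (pair u w) ≤ σ (cycle n) (pair u₁ u₂)
corollary1 n adj _ 2-conn u w u≢w u₁ u₂ adjacent =
  ≤-trans (σ≤staircase {n} 2-conn u≢w) (staircase≤σ-edge {n} adjacent)
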